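{- Let $\tau$ be a permutation in the consecutive pattern poset $S$ which is not monotone, with $|\tau|\ge2$. Then: (1) The interval $[i(\tau),\tau]$ has exactly two maximal chains, and if $C$ is the second of them in the lexicographic order of chain ids, then $C$ has a (strictly) decreasing chain id and $C(\tau,i(\tau))$ is the unique minimal skipped interval of $C$. (2) If $x(\tau)\not\le i(\tau)$, then the interval $[x(\tau),\tau]$ has exactly two maximal chains, and if $C$ is the second of them in the lexicographic order of chain ids, then $C$ has a (strictly) decreasing chain id and $C(\tau,x(\tau))$ is the unique minimal skipped interval of $C$.
   Context: For $d\ge1$, $S_d$ is the set of permutations of $\{1,\dots,d\}$ in one-line notation, $S=\bigcup_{d>0}S_d$, and $|\tau|=d$ for $\tau\in S_d$. The standard form of a sequence of distinct integers $s(1)\ldots s(k)$ is the permutation in $S_k$ whose entries are in the same relative order. The consecutive pattern poset orders $S$ by $\sigma\le\tau$ ($\sigma\in S_k$, $\tau\in S_d$) iff for some $i$ the standard form of $\tau(i+1)\ldots\tau(i+k)$ equals $\sigma$. A permutation is monotone if its entries are strictly increasing or strictly decreasing. A prefix (resp. suffix) of length $k$ of $\tau\in S_d$ is the standard form of its first (resp. last) $k$ letters; it is proper if $k<d$. For $d>2$ the interior $i(\tau)$ is the standard form of $\tau(2)\ldots\tau(d-1)$. The exterior $x(\tau)$ is the longest permutation which is both a proper prefix and a suffix of $\tau$. In a maximal chain $\tau=\rho_0\to\cdots\to\rho_n=\sigma$ of $[\sigma,\tau]$ ($\to$ denotes a cover, $|\rho_i|=|\tau|-i$), the chain id $l_1\ldots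 l_n$ is defined inductively by windows of positions of $\tau$: $W_0=\{1,\dots,|\tau|\}$; given $W_{i-1}=\{a,\dots,b\}$ with the standard form of $\tau(a)\ldots\tau(b)$ equal to $\rho_{i-1}$: if $\rho_{i-1}$ is not monotone, exactly one of the standard forms of $\tau(a+1)\ldots\tau(b)$ and $\tau(a)\ldots\tau(b-1)$ equals $\rho_i$; in the first case put $l_i=a$, $W_i=\{a+1,\dots,b\}$, in the second $l_i=b$, $W_i=\{a,\dots,b-1\}$; if $\rho_{i-1}$ is monotone put $l_i=a$, $W_i=\{a+1,\dots,b\}$. Maximal chains of an interval are totally ordered by the lexicographic order of their chain ids. For $0\le i<j\le n$, $C(\rho_i,\rho_j)=\{\rho_{i+1},\dots,\rho_{j-1}\}$. A nonempty $C(\rho_i,\rho_j)$ is a skipped interval of $C$ if the set of elements of $C$ not in $C(\rho_i,\rho_j)$ is contained in some maximal chain of the same interval lexicographically earlier than $C$; it is a minimal skipped interval if it properly contains no other skipped interval of $C$. -}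

module Defs where

open import Data.Nat using (ℕ; zero; suc; _+_; _∸_; _≤_; _<_; _>_; _<?_; _>?_; _≟_)
open import Data.Bool using (Bool; true; false; if_then_else_; _∨_)
open import Data.List using (List; []; _∷_; _++_; length; map; take; drop; filter; upTo; last)
open import Data.List.Properties using (≡-dec)
open import Data.List.Relation.Unary.Linked using (Linked; linked?)
open import Data.List.Relation.Binary.Permutation.Propositional using (_↭_)
open import Data.List.Relation.Binary.Subset.Propositional using (_⊆_)
open import Data.List.Relation.Binary.Lex.Strict using (Lex-<)
open import Data.Maybe using (Maybe; just)
open import Data.Product using (Σ; ∃; _×_; _,_)
open import Data.Sum using (_⊎_)
open import Relation.Nullary using (¬_; does)
open import Relation.Binary.PropositionalEquality using (_≡_; _≢_)

-- Permutations are lists of naturals in one-line notation.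
-- τ ∈ S_d  iff  d ≥ 1 and τ is a rearrangement of 1 … d  (d = length τ).
IsPerm : List ℕ → Set
IsPerm τ = (1 ≤ length τ) × (τ ↭ map suc (upTo (length τ)))

std : List ℕ → List ℕ
std l = map (λ x → suc (length (filter (_<? x) l))) l

_≼_ : List ℕ → List ℕ → Set
σ ≼ τ = IsPerm σ × IsPerm τ ×
        ∃ λ i → (i + length σ ≤ length τ) × (std (take (length σ) (drop i τ)) ≡ σ)

_≺_ : List ℕ → List ℕ → Set
σ ≺ τ = (σ ≼ τ) × (σ ≢ τ)

_⋖_ : List ℕ → List ℕ → Set
σ ⋖ τ = (σ ≺ τ) × (∀ ρ → σ ≺ ρ → ¬ (ρ ≺ τ))

Monotone : List ℕ → Set
Monotone ρ = Linked _<_ ρ ⊎ Linked _>_ ρ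

isMonotone : List ℕ → Bool
isMonotone ρ = does (linked? _<?_ ρ) ∨ does (linked? _>?_ ρ)

ProperPrefix : List ℕ → List ℕ → Set
ProperPrefix ξ τ = (1 ≤ length ξ) × (length ξ < length τ) × (std (take (length ξ) τ) ≡ ξ)

Suffix : List ℕ → List ℕ → Set
Suffix ξ τ = (1 ≤ length ξ) × (length ξ ≤ length τ) × (std (drop (length τ ∸ length ξ) τ) ≡ ξ)

interior : List ℕ → List ℕ
interior τ = std (drop 1 (take (length τ ∸ 1) τ))

IsExterior : List ℕ → List ℕ → Set
IsExterior τ ξ = ProperPrefix ξ τ × Suffix ξ τ ×
                 (∀ η → ProperPrefix η τ → Suffix η τ → length η ≤ length ξ)

MaxChain : List ℕ → List ℕ → List (List ℕ) → Set
MaxChain σ τ C = (Σ (List (List ℕ)) λ rest → C ≡ τ ∷ rest) × (last C ≡ just σ) ×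
                 Linked (λ a b → b ⋖ a) C

-- chain id, computed with windows of positions of τ.
-- The current window is {s+1, …, s+len} (1-indexed).
window : List ℕ → ℕ → ℕ → List ℕ
window τ s len = take len (drop s τ)

idAux : List ℕ → ℕ → ℕ → List (List ℕ) → List ℕ
idAux τ s len (ρ ∷ ρ' ∷ rest) =
  if isMonotone ρ
  then suc s ∷ idAux τ (suc s) (len ∸ 1) (ρ' ∷ rest)
  else (if does (≡-dec _≟_ (std (window τ (suc s) (len ∸ 1))) ρ')
        then suc s ∷ idAux τ (suc s) (len ∸ 1) (ρ' ∷ rest)
        else (s + len) ∷ idAux τ s (len ∸ 1) (ρ' ∷ rest))
idAux τ s len _ = []

chainId : List ℕ → List (List ℕ) → List ℕ
chainId τ C = idAux τ 0 (length τ) C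

_<lex_ : List ℕ → List ℕ → Set
_<lex_ = Lex-< _≡_ _<_

StrictlyDecreasing : List ℕ → Set
StrictlyDecreasing = Linked _>_

-- for C = ρ₀ … ρₙ and i < j:  C(ρᵢ,ρⱼ) = {ρ_{i+1}, …, ρ_{j-1}}
segment : List (List ℕ) → ℕ → ℕ → List (List ℕ)
segment C i j = take (j ∸ suc i) (drop (suc i) C)

outside : List (List ℕ) → ℕ → ℕ → List (List ℕ)
outside C i j = take (suc i) C ++ drop j C

Skipped : List ℕ → List ℕ → List (List ℕ) → ℕ → ℕ → Set
Skipped σ τ C i j =
  (i < j) × (suc j ≤ length C) × (segment C i j ≢ []) ×
  ∃ λ C' → MaxChain σ τ C' × (chainId τ C' <lex chainId τ C) × (outside C i j ⊆ C')

MinSkipped : List ℕ → List ℕ → List (List ℕ) → ℕ → ℕ → Set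
MinSkipped σ τ C i j =
  Skipped σ τ C i j ×
  (∀ i' j' → Skipped σ τ C i' j' → segment C i' j' ⊆ segment C i j → segment C i j ⊆ segment C i' j')

UniqueMinSkippedWhole : List ℕ → List ℕ → List (List ℕ) → Set
UniqueMinSkippedWhole σ τ C =
  MinSkipped σ τ C 0 (length C ∸ 1) ×
  (∀ i j → MinSkipped σ τ C i j → segment C i j ≡ segment C 0 (length C ∸ 1))

TwoChainsProperty : List ℕ → List ℕ → Set
TwoChainsProperty σ τ =
  ∃ λ C₁ → ∃ λ C₂ →
    MaxChain σ τ C₁ × MaxChain σ τ C₂ × (C₁ ≢ C₂) ×
    (∀ C → MaxChain σ τ C → (C ≡ C₁) ⊎ (C ≡ C₂)) ×
    (chainId τ C₁ <lex chainId τ C₂) ×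
    StrictlyDecreasing (chainId τ C₂) ×
    UniqueMinSkippedWhole σ τ C₂

module Submission where

-- Fix a non-monotone permutation τ of length d ≥ 3 (permutations of length 2 are monotone)
-- and write  win a b  for the standard form of its window τ(a+1) … τ(a+b).
--  * Standard forms only see relative order: two sequences have the same standard form iff
--    they are order-isomorphic (_≅_), and ≅ is preserved by taking windows.  Hence every
--    pattern of a window of τ is a window of it, and the elements covered by  win a (b+1)  are
--    exactly its two subwindows  win a b  and  win (a+1) b  (covered-by-window).
--  * A prefix is monotone iff deleting its first or its last letter gives the same standard
--    form; this decides which label a chain id records at each step (idAux-first/-last).
--  * If an interval has exactly two maximal chains, the later one in lexicographic order
--    meeting the earlier one only at its ends, then the whole interior of the later chain is
--    its unique minimal skipped interval (module TwoChains).
-- Part (1): the maximal chains of [i(τ),τ] are τ ⋗ S ⋗ i(τ) and τ ⋗ P ⋗ i(τ), P and S the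
-- prefix and suffix of length d-1, with chain ids 1 … and d 1 (module Interior).
-- Part (2): the maximal chains of [x(τ),τ] are the chain of prefixes and the chain of
-- suffixes of τ down to x(τ), since any other cover lies inside the interior; the chain of
-- prefixes has the decreasing id d, d-1, …, comes second, and meets the chain of suffixes only
-- at its ends because x(τ) is the longest common prefix and suffix (module Exterior).

open import Defs
open import Data.Nat using (ℕ; zero; suc; _+_; _∸_; _≤_; _<_; _<?_; _>?_; _≟_; z≤n; s≤s; s≤s⁻¹)
open import Data.Nat.Properties
open import Data.Bool using (true; false)
open import Data.List using (List; []; _∷_; length; map; take; drop; filter; upTo; last)
open import Data.List.Properties
  using (filter-accept; filter-reject; filter-none; map-upTo; length-upTo; map-id-local; map-cong-local;
         length-map; take-all; drop-drop; length-drop; ≡-dec; ∷-injectiveˡ; ∷-injectiveʳ)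
open import Data.List.Relation.Binary.Pointwise as PW using (Pointwise; []; _∷_)
open import Data.List.Relation.Unary.All as All using (All; []; _∷_)
open import Data.List.Relation.Unary.AllPairs as AllPairs using (AllPairs; []; _∷_)
import Data.List.Relation.Unary.AllPairs.Properties as APP
open import Data.List.Relation.Unary.Linked using (Linked; []; [-]; _∷_; linked?)
open import Data.List.Relation.Unary.Linked.Properties using (Linked⇒AllPairs)
open import Data.List.Relation.Unary.Unique.Propositional using (Unique)
import Data.List.Relation.Unary.Unique.Propositional.Properties as UniqueP
import Data.List.Relation.Binary.Sublist.Propositional as Sublist
import Data.List.Relation.Binary.Sublist.Propositional.Properties as Sub
open import Data.List.Relation.Binary.Permutation.Propositional using (_↭_; ↭-refl; ↭-sym; ↭-trans; ↭⇒↭ₛ)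
open import Data.List.Relation.Binary.Permutation.Propositional.Properties using (map⁺; ↭-length; filter-↭; ∈-resp-↭)
import Data.List.Relation.Binary.Permutation.Setoid.Properties as PermSetoid
open import Data.List.Relation.Binary.Subset.Propositional using (_⊆_)
import Data.List.Relation.Binary.Lex.Strict as LexStrict
open import Data.List.Relation.Binary.Lex.Core using (this)
open import Data.List.Membership.Propositional using (_∈_; _∉_)
open import Data.List.Membership.Propositional.Properties using (∈-++⁺ˡ; ∈-++⁺ʳ)
open import Data.List.Relation.Unary.Any using (here; there)
import Data.List.Sort as Sort
open import Data.Maybe using (just)
open import Data.Maybe.Properties using (just-injective)
open import Data.Product using (∃; _×_; _,_; proj₁; proj₂)
open import Data.Sum using (_⊎_; inj₁; inj₂)
open import Data.Empty using (⊥-elim)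
open import Function using (_∘_; id; flip; _⇔_; mk⇔; Equivalence)
open import Function.Properties.Equivalence using (⇔-isEquivalence)
open import Level using (0ℓ)
open import Relation.Binary.Definitions using (tri<; tri≈; tri>)
open import Relation.Binary.Structures using (IsEquivalence)
open import Relation.Nullary using (¬_; yes; no)
open import Relation.Binary.PropositionalEquality

module ⇔ = IsEquivalence (⇔-isEquivalence {ℓ = 0ℓ})

length-window : ∀ a b (l : List ℕ) → a + b ≤ length l → length (take b (drop a l)) ≡ b
length-window zero    zero    l       _         = refl
length-window zero    (suc b) (x ∷ l) (s≤s a+b≤) = cong suc (length-window zero b l a+b≤)
length-window (suc a) b       (x ∷ l) (s≤s a+b≤) = length-window a b l a+b≤

take-drop-take : ∀ i r s (l : List ℕ) → i + r ≤ s → take r (drop i (take s l)) ≡ take r (drop i l)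
take-drop-take zero    zero    s       l       _           = refl
take-drop-take zero    (suc r) (suc s) []      _           = refl
take-drop-take zero    (suc r) (suc s) (x ∷ l) (s≤s r≤s)   = cong (x ∷_) (take-drop-take zero r s l r≤s)
take-drop-take (suc i) r       (suc s) []      _           = refl
take-drop-take (suc i) r       (suc s) (x ∷ l) (s≤s i+r≤s) = take-drop-take i r s l i+r≤s

window-window : ∀ i r s j (l : List ℕ) → i + r ≤ s → take r (drop i (take s (drop j l))) ≡ take r (drop (j + i) l)
window-window i r s j l i+r≤s = trans (take-drop-take i r s (drop j l) i+r≤s) (cong (take r) (drop-drop j i l))

Pointwise-take : ∀ {R : ℕ → ℕ → Set} n {a b} → Pointwise R a b → Pointwise R (take n a) (take n b)
Pointwise-take zero    p       = []
Pointwise-take (suc n) []      = []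
Pointwise-take (suc n) (r ∷ p) = r ∷ Pointwise-take n p

Pointwise-zip : ∀ {R S T : ℕ → ℕ → Set} → (∀ {u v} → R u v → S u v → T u v) →
                ∀ {a b} → Pointwise R a b → Pointwise S a b → Pointwise T a b
Pointwise-zip f []      []      = []
Pointwise-zip f (r ∷ p) (s ∷ q) = f r s ∷ Pointwise-zip f p q

Agree : ℕ → ℕ → ℕ → ℕ → Set
Agree x y u v = (u < x ⇔ v < y) × (x < u ⇔ y < v)

Agree-sym : ∀ {x y u v} → Agree x y u v → Agree y x v u
Agree-sym (p , q) = ⇔.sym p , ⇔.sym q

Agree-trans : ∀ {x y z u v w} → Agree x y u v → Agree y z v w → Agree x z u w
Agree-trans (p , q) (p′ , q′) = ⇔.trans p p′ , ⇔.trans q q′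

-- a ≅ b : the sequences a and b are order-isomorphic (same length, same relative order)
infix 4 _≅_
data _≅_ : List ℕ → List ℕ → Set where
  []  : [] ≅ []
  _∷_ : ∀ {x y a b} → Pointwise (Agree x y) a b → a ≅ b → x ∷ a ≅ y ∷ b

≅-sym : ∀ {a b} → a ≅ b → b ≅ a
≅-sym []      = []
≅-sym (h ∷ i) = PW.symmetric Agree-sym h ∷ ≅-sym i

≅-trans : ∀ {a b c} → a ≅ b → b ≅ c → a ≅ c
≅-trans []      []        = []
≅-trans (h ∷ i) (h′ ∷ i′) = PW.transitive Agree-trans h h′ ∷ ≅-trans i i′

≅-take : ∀ n {a b} → a ≅ b → take n a ≅ take n b
≅-take zero    i       = []
≅-take (suc n) []      = []
≅-take (suc n) (h ∷ i) = Pointwise-take n h ∷ ≅-take n i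

≅-drop : ∀ n {a b} → a ≅ b → drop n a ≅ drop n b
≅-drop zero    i       = i
≅-drop (suc n) []      = []
≅-drop (suc n) (h ∷ i) = ≅-drop n i

rank : List ℕ → ℕ → ℕ
rank l x = length (filter (_<? x) l)

rank-∷-< : ∀ {u x} a → u < x → rank (u ∷ a) x ≡ suc (rank a x)
rank-∷-< {u} {x} a u<x = cong length (filter-accept (_<? x) {u} {a} u<x)

rank-∷-≮ : ∀ {u x} a → ¬ u < x → rank (u ∷ a) x ≡ rank a x
rank-∷-≮ {u} {x} a u≮x = cong length (filter-reject (_<? x) {u} {a} u≮x)

rank-agree : ∀ {x y a b} → Pointwise (λ u v → u < x ⇔ v < y) a b → rank a x ≡ rank b y
rank-agree [] = refl
rank-agree {x} {y} (_∷_ {u} {v} {a} {b} e p) with u <? x | v <? y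
... | yes u<x | yes v<y = begin
  rank (u ∷ a) x ≡⟨ rank-∷-< a u<x ⟩
  suc (rank a x) ≡⟨ cong suc (rank-agree p) ⟩
  suc (rank b y) ≡⟨ rank-∷-< b v<y ⟨
  rank (v ∷ b) y ∎ where open ≡-Reasoning
... | yes u<x | no v≮y  = ⊥-elim (v≮y (Equivalence.to e u<x))
... | no u≮x  | yes v<y = ⊥-elim (u≮x (Equivalence.from e v<y))
... | no u≮x  | no v≮y  = begin
  rank (u ∷ a) x ≡⟨ rank-∷-≮ a u≮x ⟩
  rank a x       ≡⟨ rank-agree p ⟩
  rank b y       ≡⟨ rank-∷-≮ b v≮y ⟨
  rank (v ∷ b) y ∎ where open ≡-Reasoning

≅-rows : ∀ {a b} → a ≅ b → Pointwise (λ x y → Pointwise (λ u v → u < x ⇔ v < y) a b) a b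
≅-rows []      = []
≅-rows (h ∷ i) =
  (irrefl ∷ PW.map proj₁ h) ∷ Pointwise-zip _∷_ (PW.map proj₂ h) (≅-rows i)
  where
  irrefl : ∀ {x y} → x < x ⇔ y < y
  irrefl = mk⇔ (λ x<x → ⊥-elim (<-irrefl refl x<x)) (λ y<y → ⊥-elim (<-irrefl refl y<y))

≅⇒std≡ : ∀ {a b} → a ≅ b → std a ≡ std b
≅⇒std≡ i = PW.Pointwise-≡⇒≡ (PW.map⁺ _ _ (PW.map (cong suc ∘ rank-agree) (≅-rows i)))

rank-mono : ∀ {x y} → x ≤ y → ∀ l → rank l x ≤ rank l y
rank-mono x≤y l =
  Sub.length-mono-≤ (Sub.filter⁺ (_<? _) (_<? _) (λ { refl u<x → <-≤-trans u<x x≤y }) (Sublist.⊆-refl {x = l}))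

rank-strict : ∀ {u x} l → u ∈ l → u < x → rank l u < rank l x
rank-strict {u} {x} (w ∷ l) (here refl) u<x = begin-strict
  rank (u ∷ l) u ≡⟨ rank-∷-≮ l (<-irrefl refl) ⟩
  rank l u       ≤⟨ rank-mono (<⇒≤ u<x) l ⟩
  rank l x       <⟨ n<1+n _ ⟩
  suc (rank l x) ≡⟨ rank-∷-< l u<x ⟨
  rank (u ∷ l) x ∎ where open ≤-Reasoning
rank-strict {u} {x} (w ∷ l) (there u∈l) u<x with w <? u
... | yes w<u = begin-strict
  rank (w ∷ l) u ≡⟨ rank-∷-< l w<u ⟩
  suc (rank l u) <⟨ s≤s (rank-strict l u∈l u<x) ⟩
  suc (rank l x) ≡⟨ rank-∷-< l (<-trans w<u u<x) ⟨
  rank (w ∷ l) x ∎ where open ≤-Reasoning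
... | no w≮u = begin-strict
  rank (w ∷ l) u ≡⟨ rank-∷-≮ l w≮u ⟩
  rank l u       <⟨ rank-strict l u∈l u<x ⟩
  rank l x       ≤⟨ Sub.length-mono-≤ (Sub.filter⁺ (_<? x) (_<? x) (λ { refl p → p }) (w Sublist.∷ʳ Sublist.⊆-refl)) ⟩
  rank (w ∷ l) x ∎ where open ≤-Reasoning

≅-std : ∀ l → l ≅ std l
≅-std l = iso l (All.tabulate (λ m → m))
  where
  r : ℕ → ℕ
  r x = suc (rank l x)

  r-reflects : ∀ {u x} → r u < r x → u < x
  r-reflects {u} {x} ru<rx with u <? x
  ... | yes u<x = u<x
  ... | no u≮x  = ⊥-elim (<-irrefl refl (<-≤-trans ru<rx (s≤s (rank-mono (≮⇒≥ u≮x) l))))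

  r-agree : ∀ {u x} → u ∈ l → x ∈ l → Agree x (r x) u (r u)
  r-agree u∈l x∈l = mk⇔ (s≤s ∘ rank-strict l u∈l) r-reflects , mk⇔ (s≤s ∘ rank-strict l x∈l) r-reflects

  iso : ∀ s → All (_∈ l) s → s ≅ map r s
  iso []      []          = []
  iso (x ∷ s) (x∈l ∷ s⊆l) = agrees s⊆l ∷ iso s s⊆l
    where
    agrees : ∀ {t} → All (_∈ l) t → Pointwise (Agree x (r x)) t (map r t)
    agrees []          = []
    agrees (u∈l ∷ t⊆l) = r-agree u∈l x∈l ∷ agrees t⊆l

std≡⇒≅ : ∀ {a b} → std a ≡ std b → a ≅ b
std≡⇒≅ {a} {b} e = ≅-trans (≅-std a) (subst (_≅ b) (sym e) (≅-sym (≅-std b)))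

≅-linked : ∀ {R : ℕ → ℕ → Set} → (∀ {x y u v} → Agree x y u v → R x u → R y v) →
           ∀ {a b} → a ≅ b → Linked R a → Linked R b
≅-linked agree []                   []      = []
≅-linked agree ([] ∷ [])            [-]     = [-]
≅-linked agree ((h ∷ _) ∷ i@(_ ∷ _)) (r ∷ l) = agree h r ∷ ≅-linked agree i l

≅-monotone : ∀ {a b} → a ≅ b → Monotone a → Monotone b
≅-monotone i (inj₁ inc) = inj₁ (≅-linked (λ h → Equivalence.to (proj₂ h)) i inc)
≅-monotone i (inj₂ dec) = inj₂ (≅-linked (λ h → Equivalence.to (proj₁ h)) i dec)

≅-sorted : ∀ {R : ℕ → ℕ → Set} → (∀ {x y u v} → R x u → R y v → Agree x y u v) →
           ∀ {a b} → AllPairs R a → AllPairs R b → length a ≡ length b → a ≅ b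
≅-sorted agree []        []        _ = []
≅-sorted agree (ra ∷ pa) (rb ∷ pb) e = row ra rb (suc-injective e) ∷ ≅-sorted agree pa pb (suc-injective e)
  where
  row : ∀ {x y a b} → All _ a → All _ b → length a ≡ length b → Pointwise (Agree x y) a b
  row []        []        _ = []
  row (r ∷ rs)  (s ∷ ss)  e = agree r s ∷ row rs ss (suc-injective e)

agree-above : ∀ {x y u v} → x < u → y < v → Agree x y u v
agree-above x<u y<v = mk⇔ (λ u<x → ⊥-elim (<-asym x<u u<x)) (λ v<y → ⊥-elim (<-asym y<v v<y)) ,
                      mk⇔ (λ _ → y<v) (λ _ → x<u)

agree-below : ∀ {x y u v} → u < x → v < y → Agree x y u v
agree-below u<x v<y = mk⇔ (λ _ → v<y) (λ _ → u<x) ,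
                      mk⇔ (λ x<u → ⊥-elim (<-asym x<u u<x)) (λ y<v → ⊥-elim (<-asym y<v v<y))

equal-lengths : ∀ {l n} → suc n ≤ length l → length (take n l) ≡ length (take n (drop 1 l))
equal-lengths {l} {n} n<l = trans (length-window 0 n l (<⇒≤ n<l)) (sym (length-window 1 n l n<l))

monotone⇒shift : ∀ {l} n → Monotone l → suc n ≤ length l → take n l ≅ take n (drop 1 l)
monotone⇒shift {l} n (inj₁ inc) n<l = ≅-sorted agree-above
  (APP.take⁺ n (Linked⇒AllPairs <-trans inc)) (APP.take⁺ n (APP.drop⁺ 1 (Linked⇒AllPairs <-trans inc)))
  (equal-lengths n<l)
monotone⇒shift {l} n (inj₂ dec) n<l = ≅-sorted agree-below
  (APP.take⁺ n (Linked⇒AllPairs (flip <-trans) dec)) (APP.take⁺ n (APP.drop⁺ 1 (Linked⇒AllPairs (flip <-trans) dec)))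
  (equal-lengths n<l)


pair-monotone : ∀ {x y} → x ≢ y → Monotone (x ∷ y ∷ [])
pair-monotone {x} {y} x≢y with <-cmp x y
... | tri< x<y _ _ = inj₁ (x<y ∷ [-])
... | tri≈ _ x≡y _ = ⊥-elim (x≢y x≡y)
... | tri> _ _ x>y = inj₂ (x>y ∷ [-])

shift⇒monotone : ∀ n l → Unique l → take n l ≅ take n (drop 1 l) → Monotone (take (suc n) l)
shift⇒monotone zero          []              _                _ = inj₁ []
shift⇒monotone zero          (x ∷ l)         _                _ = inj₁ [-]
shift⇒monotone (suc n)       []              _                _ = inj₁ []
shift⇒monotone (suc n)       (x ∷ [])        _                _ = inj₁ [-]
shift⇒monotone (suc zero)    (x ∷ y ∷ l)     ((x≢y ∷ _) ∷ _)  _ = pair-monotone x≢y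
shift⇒monotone (suc (suc n)) (x ∷ y ∷ [])    ((x≢y ∷ _) ∷ _)  _ = pair-monotone x≢y
shift⇒monotone (suc (suc n)) (x ∷ y ∷ z ∷ l) (_ ∷ u) ((h ∷ _) ∷ i) with shift⇒monotone (suc n) (y ∷ z ∷ l) u i
... | inj₁ (y<z ∷ inc) = inj₁ (Equivalence.from (proj₂ h) y<z ∷ y<z ∷ inc)
... | inj₂ (y>z ∷ dec) = inj₂ (Equivalence.from (proj₁ h) y>z ∷ y>z ∷ dec)

identity : ℕ → List ℕ
identity n = map suc (upTo n)

std-∷-minimum : ∀ {x xs} → All (x <_) xs → std (x ∷ xs) ≡ 1 ∷ map suc (std xs)
std-∷-minimum {x} {xs} x<xs = cong₂ _∷_ (cong suc rank-x) (ranks xs x<xs)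
  where
  rank-x : rank (x ∷ xs) x ≡ 0
  rank-x = trans (rank-∷-≮ xs (<-irrefl refl)) (cong length (filter-none (_<? x) (All.map <⇒≯ x<xs)))
  ranks : ∀ ys → All (x <_) ys → map (λ w → suc (rank (x ∷ xs) w)) ys ≡ map suc (map (λ w → suc (rank xs w)) ys)
  ranks []       []          = refl
  ranks (y ∷ ys) (x<y ∷ x<ys) = cong₂ _∷_ (cong suc (rank-∷-< xs x<y)) (ranks ys x<ys)

std-increasing : ∀ {l} → AllPairs _<_ l → std l ≡ identity (length l)
std-increasing []                   = refl
std-increasing {x ∷ xs} (x<xs ∷ inc) = begin
  std (x ∷ xs)                          ≡⟨ std-∷-minimum x<xs ⟩
  1 ∷ map suc (std xs)                  ≡⟨ cong (λ l → 1 ∷ map suc l) (std-increasing inc) ⟩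
  1 ∷ map suc (identity (length xs))    ≡⟨ cong (λ l → 1 ∷ map suc l) (map-upTo suc (length xs)) ⟩
  identity (length (x ∷ xs))            ∎ where open ≡-Reasoning

identity-increasing : ∀ n → AllPairs _<_ (identity n)
identity-increasing n = APP.map⁺ (APP.applyUpTo⁺₁ id n (λ i<j _ → s≤s i<j))

rank-↭ : ∀ {a b} → a ↭ b → ∀ w → rank a w ≡ rank b w
rank-↭ a↭b w = ↭-length (filter-↭ (_<? w) a↭b)

std-↭ : ∀ {a b} → a ↭ b → std a ↭ std b
std-↭ {a} {b} a↭b = subst (std a ↭_) (map-cong-local (All.tabulate (λ {w} _ → cong suc (rank-↭ a↭b w)))) (map⁺ _ a↭b)

map-fixed : ∀ (f : ℕ → ℕ) l → map f l ≡ l → All (λ w → f w ≡ w) l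
map-fixed f []      _  = []
map-fixed f (x ∷ l) fl = ∷-injectiveˡ fl ∷ map-fixed f l (∷-injectiveʳ fl)

std-perm : ∀ {τ} → IsPerm τ → std τ ≡ τ
std-perm {τ} (_ , τ↭ι) = map-id-local (All.tabulate fixed)
  where
  ι : List ℕ
  ι = identity (length τ)
  ι-fixed : All (λ w → suc (rank ι w) ≡ w) ι
  ι-fixed = map-fixed _ ι (trans (std-increasing (identity-increasing _))
                                 (cong identity (trans (length-map suc (upTo (length τ))) (length-upTo (length τ)))))
  fixed : ∀ {w} → w ∈ τ → suc (rank τ w) ≡ w
  fixed {w} w∈τ = trans (cong suc (rank-↭ τ↭ι w)) (All.lookup ι-fixed (∈-resp-↭ τ↭ι w∈τ))

Unique-↭ : ∀ {a b} → a ↭ b → Unique a → Unique b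
Unique-↭ a↭b = PermSetoid.Unique-resp-↭ (setoid ℕ) (↭⇒↭ₛ a↭b)

perm-unique : ∀ {τ} → IsPerm τ → Unique τ
perm-unique {τ} (_ , τ↭ι) = Unique-↭ (↭-sym τ↭ι) (UniqueP.map⁺ suc-injective (UniqueP.upTo⁺ (length τ)))

module Sorting = Sort ≤-decTotalOrder

-- the standard form of a nonempty sequence of distinct numbers is a permutation: it is
-- a rearrangement of the standard form of the sorted sequence, which is 1 2 … n
std-unique-perm : ∀ l → Unique l → 1 ≤ length l → IsPerm (std l)
std-unique-perm l u 1≤l = subst (1 ≤_) (sym (length-map _ l)) 1≤l ,
  ↭-trans (std-↭ (↭-sym (Sorting.sort-↭ l))) (subst (std (Sorting.sort l) ↭_) sorted-std ↭-refl)
  where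
  s : List ℕ
  s = Sorting.sort l
  increasing : AllPairs _<_ s
  increasing = AllPairs.zipWith (λ (x≤y , x≢y) → ≤∧≢⇒< x≤y x≢y)
    (Linked⇒AllPairs ≤-trans (Sorting.sort-↗ l) , Unique-↭ (↭-sym (Sorting.sort-↭ l)) u)
  sorted-std : std s ≡ identity (length (std l))
  sorted-std = trans (std-increasing increasing) (cong identity (trans (↭-length (Sorting.sort-↭ l)) (sym (length-map _ l))))

std-window-std : ∀ r i w → std (take r (drop i (std w))) ≡ std (take r (drop i w))
std-window-std r i w = ≅⇒std≡ (≅-take r (≅-drop i (≅-sym (≅-std w))))

≼-length : ∀ {σ ρ} → σ ≼ ρ → length σ ≤ length ρ
≼-length (_ , _ , i , fits , _) = m+n≤o⇒n≤o i fits

≼-equal-length : ∀ {σ ρ} → σ ≼ ρ → length σ ≡ length ρ → σ ≡ ρ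
≼-equal-length {σ} {ρ} (_ , ρ-perm , zero , _ , occ) σ≡ρ = begin
  σ                       ≡⟨ occ ⟨
  std (take (length σ) ρ) ≡⟨ cong (λ n → std (take n ρ)) σ≡ρ ⟩
  std (take (length ρ) ρ) ≡⟨ cong std (take-all (length ρ) ρ ≤-refl) ⟩
  std ρ                   ≡⟨ std-perm ρ-perm ⟩
  ρ                       ∎ where open ≡-Reasoning
≼-equal-length {σ} {ρ} (_ , _ , suc i , fits , _) σ≡ρ =
  ⊥-elim (<-irrefl refl (≤-trans (s≤s (m≤n+m (length σ) i)) (≤-trans fits (≤-reflexive (sym σ≡ρ)))))

≺-length : ∀ {σ ρ} → σ ≺ ρ → length σ < length ρ
≺-length (σ≼ρ , σ≢ρ) = ≤∧≢⇒< (≼-length σ≼ρ) (σ≢ρ ∘ ≼-equal-length σ≼ρ)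

≺-by-length : ∀ {σ ρ} → σ ≼ ρ → length σ < length ρ → σ ≺ ρ
≺-by-length σ≼ρ σ<ρ = σ≼ρ , λ { refl → <-irrefl refl σ<ρ }

⋖-by-length : ∀ {σ ρ} → σ ≼ ρ → suc (length σ) ≡ length ρ → σ ⋖ ρ
⋖-by-length σ≼ρ σ+1≡ρ = ≺-by-length σ≼ρ (≤-reflexive σ+1≡ρ) ,
  λ π σ≺π π≺ρ → <-irrefl refl
    (<-≤-trans (≺-length σ≺π) (s≤s⁻¹ (≤-trans (≺-length π≺ρ) (≤-reflexive (sym σ+1≡ρ)))))

≼-refl : ∀ {σ} → IsPerm σ → σ ≼ σ
≼-refl {σ} σ-perm = σ-perm , σ-perm , 0 , ≤-refl , trans (cong std (take-all (length σ) σ ≤-refl)) (std-perm σ-perm)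

≼-trans : ∀ {σ ρ π} → σ ≼ ρ → ρ ≼ π → σ ≼ π
≼-trans {σ} {ρ} {π} (σ-perm , _ , i , fits , occ) (_ , π-perm , j , fits′ , occ′) =
  σ-perm , π-perm , j + i , ≤-trans (≤-reflexive (+-assoc j i (length σ))) (≤-trans (+-monoʳ-≤ j fits) fits′) ,
  (begin
    std (take (length σ) (drop (j + i) π))
      ≡⟨ cong std (window-window i (length σ) (length ρ) j π fits) ⟨
    std (take (length σ) (drop i (take (length ρ) (drop j π))))
      ≡⟨ std-window-std (length σ) i _ ⟨
    std (take (length σ) (drop i (std (take (length ρ) (drop j π)))))
      ≡⟨ cong (λ w → std (take (length σ) (drop i w))) occ′ ⟩
    std (take (length σ) (drop i ρ))
      ≡⟨ occ ⟩
    σ ∎)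
  where open ≡-Reasoning

_⋗_ : List ℕ → List ℕ → Set
ρ ⋗ σ = σ ⋖ ρ

chain-below : ∀ {σ ρ L} → Linked _⋗_ (ρ ∷ L) → last (ρ ∷ L) ≡ just σ → IsPerm σ → σ ≼ ρ
chain-below {L = []}    _           refl σ-perm = ≼-refl σ-perm
chain-below {L = _ ∷ _} (ρ⋗ρ′ ∷ ch) ends σ-perm = ≼-trans (chain-below ch ends σ-perm) (proj₁ (proj₁ ρ⋗ρ′))

chain-stops : ∀ {σ ρ L} → Linked _⋗_ (ρ ∷ L) → last (ρ ∷ L) ≡ just σ → IsPerm σ →
              length ρ ≡ length σ → L ≡ []
chain-stops {L = []}    _           _    _      _    = refl
chain-stops {σ} {ρ} {L = ρ′ ∷ _} (ρ⋗ρ′ ∷ ch) ends σ-perm ρ≡σ = ⊥-elim (<-irrefl refl (begin-strict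
  length ρ  ≡⟨ ρ≡σ ⟩
  length σ  ≤⟨ ≼-length (chain-below ch ends σ-perm) ⟩
  length ρ′ <⟨ ≺-length (proj₁ ρ⋗ρ′) ⟩
  length ρ  ∎))
  where open ≤-Reasoning

chain-one-step : ∀ {σ ρ L} → Linked _⋗_ (ρ ∷ L) → last (ρ ∷ L) ≡ just σ → IsPerm σ →
                 length ρ ≡ suc (length σ) → L ≡ σ ∷ []
chain-one-step {L = []}     _           refl   _      ρ≡1+σ = ⊥-elim (<-irrefl ρ≡1+σ (n<1+n _))
chain-one-step {σ} {ρ} {L = ρ′ ∷ L′} (ρ⋗ρ′ ∷ ch) ends σ-perm ρ≡1+σ
  = cong₂ _∷_ (sym σ≡ρ′) (chain-stops ch ends σ-perm ρ′≡σ)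
  where
  σ≼ρ′ : σ ≼ ρ′
  σ≼ρ′ = chain-below ch ends σ-perm
  ρ′≡σ : length ρ′ ≡ length σ
  ρ′≡σ = ≤-antisym (s≤s⁻¹ (subst (length ρ′ <_) ρ≡1+σ (≺-length (proj₁ ρ⋗ρ′)))) (≼-length σ≼ρ′)
  σ≡ρ′ : σ ≡ ρ′
  σ≡ρ′ = ≼-equal-length σ≼ρ′ (sym ρ′≡σ)

-- The windows of a fixed permutation τ of length d:  win a b  is the standard form of
-- τ(a+1) … τ(a+b).  Every pattern of such a window is again a window.
module Windows (τ : List ℕ) (τ-perm : IsPerm τ) where

  d : ℕ
  d = length τ

  win : ℕ → ℕ → List ℕ
  win a b = std (take b (drop a τ))

  win-length : ∀ a b → a + b ≤ d → length (win a b) ≡ b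
  win-length a b fits = trans (length-map _ (take b (drop a τ))) (length-window a b τ fits)

  win-perm : ∀ a b → a + b ≤ d → 1 ≤ b → IsPerm (win a b)
  win-perm a b fits 1≤b = std-unique-perm _ (UniqueP.take⁺ b (UniqueP.drop⁺ a (perm-unique τ-perm)))
    (≤-trans 1≤b (≤-reflexive (sym (length-window a b τ fits))))

  win-full : τ ≡ win 0 d
  win-full = sym (trans (cong std (take-all d τ ≤-refl)) (std-perm τ-perm))

  win-window : ∀ a b j r → j + r ≤ b → std (take r (drop j (win a b))) ≡ win (a + j) r
  win-window a b j r j+r≤b = trans (std-window-std r j _) (cong std (window-window j r b a τ j+r≤b))

  subwindow-fits : ∀ a b j r → a + b ≤ d → j + r ≤ b → a + j + r ≤ d
  subwindow-fits a b j r fits j+r≤b = ≤-trans (≤-reflexive (+-assoc a j r)) (≤-trans (+-monoʳ-≤ a j+r≤b) fits)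

  win-≼ : ∀ a b j r → a + b ≤ d → j + r ≤ b → 1 ≤ r → win (a + j) r ≼ win a b
  win-≼ a b j r fits j+r≤b 1≤r =
    win-perm (a + j) r (subwindow-fits a b j r fits j+r≤b) 1≤r , win-perm a b fits (≤-trans 1≤r (m+n≤o⇒n≤o j j+r≤b)) ,
    j , subst₂ (λ m n → j + m ≤ n) (sym length-inner) (sym (win-length a b fits)) j+r≤b ,
    trans (cong (λ n → std (take n (drop j (win a b)))) length-inner) (win-window a b j r j+r≤b)
    where
    length-inner : length (win (a + j) r) ≡ r
    length-inner = win-length (a + j) r (subwindow-fits a b j r fits j+r≤b)

  pattern-of-window : ∀ {ρ} a b → a + b ≤ d → ρ ≼ win a b →
                      ∃ λ j → (j + length ρ ≤ b) × (ρ ≡ win (a + j) (length ρ))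
  pattern-of-window {ρ} a b fits (_ , _ , j , j+r≤ , occ) =
    j , j+r≤b , trans (sym occ) (win-window a b j (length ρ) j+r≤b)
    where
    j+r≤b : j + length ρ ≤ b
    j+r≤b = ≤-trans j+r≤ (≤-reflexive (win-length a b fits))

  win-⋖-init : ∀ a b → a + suc b ≤ d → 1 ≤ b → win a b ⋖ win a (suc b)
  win-⋖-init a b fits 1≤b =
    ⋖-by-length (subst (λ c → win c b ≼ win a (suc b)) (+-identityʳ a) (win-≼ a (suc b) 0 b fits (n≤1+n b) 1≤b))
    (trans (cong suc (win-length a b (≤-trans (+-monoʳ-≤ a (n≤1+n b)) fits))) (sym (win-length a (suc b) fits)))

  win-⋖-tail : ∀ a b → a + suc b ≤ d → 1 ≤ b → win (suc a) b ⋖ win a (suc b)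
  win-⋖-tail a b fits 1≤b =
    ⋖-by-length (subst (λ c → win c b ≼ win a (suc b)) (+-comm a 1) (win-≼ a (suc b) 1 b fits ≤-refl 1≤b))
    (trans (cong suc (win-length (suc a) b (≤-trans (≤-reflexive (sym (+-suc a b))) fits))) (sym (win-length a (suc b) fits)))

  cover-inside : ∀ {ρ W} a b j r → a + b ≤ d → j + r ≤ b → 1 ≤ r → ρ ≡ win (a + j) r →
                 win a b ≺ W → ρ ⋖ W → ρ ≡ win a b
  cover-inside a b j r fits j+r≤b 1≤r ρ≡ V≺W (_ , nothing-between) with m≤n⇒m<n∨m≡n (m+n≤o⇒n≤o j j+r≤b)
  ... | inj₁ r<b = ⊥-elim (nothing-between (win a b)
        (≺-by-length (subst (_≼ win a b) (sym ρ≡) (win-≼ a b j r fits j+r≤b 1≤r))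
          (subst₂ _<_ (sym (trans (cong length ρ≡) (win-length (a + j) r (subwindow-fits a b j r fits j+r≤b))))
                      (sym (win-length a b fits)) r<b))
        V≺W)
  ... | inj₂ refl with j
  ...   | zero   = trans ρ≡ (cong (λ c → win c r) (+-identityʳ a))
  ...   | suc j′ = ⊥-elim (<-irrefl refl (≤-trans (s≤s (m≤n+m r j′)) j+r≤b))

  covered-by-window : ∀ {ρ} a b → a + suc b ≤ d → ρ ⋖ win a (suc b) → (ρ ≡ win a b) ⊎ (ρ ≡ win (suc a) b)
  covered-by-window {ρ} a b fits ρ⋖W@((ρ≼W , ρ≢W) , _) with pattern-of-window a (suc b) fits ρ≼W
  ... | zero , r≤1+b , ρ≡ with m≤n⇒m<n∨m≡n r≤1+b
  ...   | inj₂ r≡1+b = ⊥-elim (ρ≢W (≼-equal-length ρ≼W (trans r≡1+b (sym (win-length a (suc b) fits)))))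
  ...   | inj₁ r<1+b = inj₁ (cover-inside a b 0 (length ρ) (≤-trans (+-monoʳ-≤ a (n≤1+n b)) fits) r≤b 1≤r ρ≡
                          (proj₁ (win-⋖-init a b fits (≤-trans 1≤r r≤b))) ρ⋖W)
    where
    r≤b : length ρ ≤ b
    r≤b = s≤s⁻¹ r<1+b
    1≤r : 1 ≤ length ρ
    1≤r = proj₁ (proj₁ ρ≼W)
  covered-by-window {ρ} a b fits ρ⋖W@((ρ≼W , _) , _) | suc j , 1+j+r≤1+b , ρ≡ =
    inj₂ (cover-inside (suc a) b j (length ρ) (≤-trans (≤-reflexive (sym (+-suc a b))) fits) j+r≤b 1≤r
           (trans ρ≡ (cong (λ c → win c (length ρ)) (+-suc a j)))
           (proj₁ (win-⋖-tail a b fits (≤-trans 1≤r (m+n≤o⇒n≤o j j+r≤b)))) ρ⋖W)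
    where
    j+r≤b : j + length ρ ≤ b
    j+r≤b = s≤s⁻¹ 1+j+r≤1+b
    1≤r : 1 ≤ length ρ
    1≤r = proj₁ (proj₁ ρ≼W)

  shift-monotone : ∀ m → win 1 m ≡ win 0 m → Monotone (win 0 (suc m))
  shift-monotone m shift-eq = ≅-monotone (≅-std (take (suc m) τ))
    (shift⇒monotone m τ (perm-unique τ-perm) (≅-sym (std≡⇒≅ shift-eq)))

  monotone-prefix-shift : ∀ b r → b ≤ d → r < b → Monotone (win 0 b) → win 0 r ≡ win 1 r
  monotone-prefix-shift b r b≤d r<b mono = begin
    win 0 r                          ≡⟨ cong std (window-window 0 r b 0 τ (<⇒≤ r<b)) ⟨
    std (take r (take b τ))          ≡⟨ ≅⇒std≡ (monotone⇒shift r monotone-take r<length) ⟩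
    std (take r (drop 1 (take b τ))) ≡⟨ cong std (window-window 1 r b 0 τ r<b) ⟩
    win 1 r                          ∎
    where
    open ≡-Reasoning
    monotone-take : Monotone (take b τ)
    monotone-take = ≅-monotone (≅-sym (≅-std (take b τ))) mono
    r<length : suc r ≤ length (take b τ)
    r<length = subst (suc r ≤_) (sym (length-window 0 b τ b≤d)) r<b

  suffix-window : ∀ m → m ≤ d → std (drop (d ∸ m) τ) ≡ win (d ∸ m) m
  suffix-window m m≤d =
    cong std (sym (take-all m (drop (d ∸ m) τ) (≤-reflexive (trans (length-drop (d ∸ m) τ) (m∸[m∸n]≡n m≤d)))))

idAux-first : ∀ τ s len ρ ρ′ C → std (window τ (suc s) (len ∸ 1)) ≡ ρ′ →
              idAux τ s len (ρ ∷ ρ′ ∷ C) ≡ suc s ∷ idAux τ (suc s) (len ∸ 1) (ρ′ ∷ C)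
idAux-first τ s len ρ ρ′ C first with isMonotone ρ | ≡-dec _≟_ (std (window τ (suc s) (len ∸ 1))) ρ′
... | true  | _      = refl
... | false | yes _  = refl
... | false | no ¬first = ⊥-elim (¬first first)

idAux-last : ∀ τ s len ρ ρ′ C → ¬ Monotone ρ → std (window τ (suc s) (len ∸ 1)) ≢ ρ′ →
             idAux τ s len (ρ ∷ ρ′ ∷ C) ≡ s + len ∷ idAux τ s (len ∸ 1) (ρ′ ∷ C)
idAux-last τ s len ρ ρ′ C ¬mono ¬first
  with linked? _<?_ ρ | linked? _>?_ ρ | ≡-dec _≟_ (std (window τ (suc s) (len ∸ 1))) ρ′
... | yes inc | _       | _         = ⊥-elim (¬mono (inj₁ inc))
... | no _    | yes dec | _         = ⊥-elim (¬mono (inj₂ dec))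
... | no _    | no _    | yes first = ⊥-elim (¬first first)
... | no _    | no _    | no _      = refl

lex-irrefl : ∀ {l} → ¬ (l <lex l)
lex-irrefl = LexStrict.<-irreflexive <-irrefl (PW.refl refl)

entry-at : ∀ {A : Set} p (l : List A) → p < length l → ∃ λ x → (∀ m → p < m → x ∈ take m l) × (x ∈ drop p l)
entry-at zero    (x ∷ l) _       = x , (λ { (suc m) _ → here refl }) , here refl
entry-at (suc p) (x ∷ l) (s≤s p<l) with entry-at p l p<l
... | y , in-prefix , in-suffix = y , (λ { (suc m) (s≤s p<m) → there (in-prefix m p<m) }) , in-suffix

last-∈ : ∀ {A : Set} {x : A} l → last l ≡ just x → x ∈ l
last-∈ (y ∷ [])     refl = here refl
last-∈ (y ∷ z ∷ l) ends = there (last-∈ (z ∷ l) ends)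

drop-to-last : ∀ {A : Set} {x : A} y l → last (y ∷ l) ≡ just x → drop (length l) (y ∷ l) ≡ x ∷ []
drop-to-last y []      refl = refl
drop-to-last y (z ∷ l) ends = drop-to-last z l ends

take-nonempty : ∀ {A : Set} m (l : List A) → 1 ≤ m → m ≤ length l → take m l ≢ []
take-nonempty (suc m) (x ∷ l) _ _ = λ ()

-- Suppose [σ,τ] has exactly the maximal chains C₁ and C₂ = τ ∷ rest, that C₁ comes first,
-- and that no element strictly inside C₂ lies on C₁.  Then the skipped intervals of C₂ are
-- exactly C(τ,σ), which is therefore its unique minimal skipped interval.
module TwoChains {σ τ : List ℕ} {C₁ rest : List (List ℕ)}
  (chain₁ : MaxChain σ τ C₁) (chain₂ : MaxChain σ τ (τ ∷ rest))
  (only : ∀ C → MaxChain σ τ C → (C ≡ C₁) ⊎ (C ≡ τ ∷ rest))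
  (first : chainId τ C₁ <lex chainId τ (τ ∷ rest))
  (long : 2 ≤ length rest)
  (disjoint : ∀ ρ → ρ ∈ take (length rest ∸ 1) rest → ρ ∉ C₁) where

  C₂ : List (List ℕ)
  C₂ = τ ∷ rest

  n : ℕ
  n = length rest

  earlier-is-C₁ : ∀ {C} → MaxChain σ τ C → chainId τ C <lex chainId τ C₂ → C ≡ C₁
  earlier-is-C₁ {C} chain earlier with only C chain
  ... | inj₁ C≡C₁ = C≡C₁
  ... | inj₂ refl = ⊥-elim (lex-irrefl earlier)

  -- positions 0 … n-2 of rest lie strictly inside C₂
  inner : ∀ {p m} → suc p < m → p < m ∸ 1
  inner {m = suc m} (s≤s 1+p≤m) = 1+p≤m

  starts-at-τ : ∀ i j → i < j → j ≤ n → outside C₂ i j ⊆ C₁ → i ≡ 0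
  starts-at-τ zero    j _ _ _ = refl
  starts-at-τ (suc i) j 1+i<j j≤n outside⊆C₁ with entry-at i rest (≤-trans (<⇒≤ 1+i<j) j≤n)
  ... | ρ , in-prefix , _ = ⊥-elim (disjoint ρ (in-prefix (n ∸ 1) (inner (<-≤-trans 1+i<j j≤n)))
                                      (outside⊆C₁ (there (∈-++⁺ˡ (in-prefix (suc i) ≤-refl)))))

  ends-at-σ : ∀ i j → i < j → j ≤ n → outside C₂ i j ⊆ C₁ → j ≡ n
  ends-at-σ i (suc j) _ 1+j≤n outside⊆C₁ with m≤n⇒m<n∨m≡n 1+j≤n
  ... | inj₂ 1+j≡n = 1+j≡n
  ... | inj₁ 1+j<n with entry-at j rest (<⇒≤ 1+j<n)
  ...   | ρ , in-prefix , in-suffix = ⊥-elim (disjoint ρ (in-prefix (n ∸ 1) (inner 1+j<n))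
                                        (outside⊆C₁ (∈-++⁺ʳ (take (suc i) C₂) in-suffix)))

  skipped-whole : ∀ {i j} → Skipped σ τ C₂ i j → (i ≡ 0) × (j ≡ n)
  skipped-whole {i} {j} (i<j , 1+j≤1+n , _ , C , chain , earlier , outside⊆C) =
    starts-at-τ i j i<j (s≤s⁻¹ 1+j≤1+n) outside⊆C₁ , ends-at-σ i j i<j (s≤s⁻¹ 1+j≤1+n) outside⊆C₁
    where
    outside⊆C₁ : outside C₂ i j ⊆ C₁
    outside⊆C₁ = subst (outside C₂ i j ⊆_) (earlier-is-C₁ chain earlier) outside⊆C

  -- … and C(τ,σ) is skipped, as C₁ contains τ and σ
  whole-skipped : Skipped σ τ C₂ 0 n
  whole-skipped = ≤-trans (s≤s z≤n) long , ≤-refl , nonempty , C₁ , chain₁ , first , outside⊆C₁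
    where
    nonempty : take (n ∸ 1) rest ≢ []
    nonempty = take-nonempty (n ∸ 1) rest (∸-monoˡ-≤ 1 long) (m∸n≤m n 1)
    τ∈C₁ : τ ∈ C₁
    τ∈C₁ = subst (τ ∈_) (sym (proj₂ (proj₁ chain₁))) (here refl)
    σ∈C₁ : σ ∈ C₁
    σ∈C₁ = last-∈ C₁ (proj₁ (proj₂ chain₁))
    outside⊆C₁ : outside C₂ 0 n ⊆ C₁
    outside⊆C₁ (here refl) = τ∈C₁
    outside⊆C₁ (there ρ∈) with subst (_ ∈_) (drop-to-last τ rest (proj₁ (proj₂ chain₂))) ρ∈
    ... | here refl = σ∈C₁

  unique-min-skipped : UniqueMinSkippedWhole σ τ C₂
  unique-min-skipped = (whole-skipped , λ i j skipped _ → ⊆-whole (skipped-whole skipped)) ,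
                       λ i j min-skipped → whole-segment (skipped-whole (proj₁ min-skipped))
    where
    ⊆-whole : ∀ {i j} → (i ≡ 0) × (j ≡ n) → segment C₂ 0 n ⊆ segment C₂ i j
    ⊆-whole (refl , refl) ρ∈ = ρ∈
    whole-segment : ∀ {i j} → (i ≡ 0) × (j ≡ n) → segment C₂ i j ≡ segment C₂ 0 n
    whole-segment (refl , refl) = refl

  -- C₁ ≠ C₂ since C₁ comes strictly first
  two-chains-property : StrictlyDecreasing (chainId τ C₂) → TwoChainsProperty σ τ
  two-chains-property decreasing =
    C₁ , C₂ , chain₁ , chain₂ , (λ { refl → lex-irrefl first }) , only , first , decreasing , unique-min-skipped

-- Let τ = x y z … have length d = e + 3 and put  P = win 0 (d-1),  S = win 1 (d-1)
-- (the prefix and the suffix of length d-1) and  I = win 1 (d-2) = i(τ).  The maximal chains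
-- of [I,τ] are  τ ⋗ S ⋗ I  and  τ ⋗ P ⋗ I, with chain ids  1 …  and  d 1.
module Interior {x y z : ℕ} {r : List ℕ}
                (τ-perm : IsPerm (x ∷ y ∷ z ∷ r)) (τ-nonmono : ¬ Monotone (x ∷ y ∷ z ∷ r)) where

  τ : List ℕ
  τ = x ∷ y ∷ z ∷ r

  open Windows τ τ-perm

  e : ℕ
  e = length r

  P S I : List ℕ
  P = win 0 (suc (suc e))
  S = win 1 (suc (suc e))
  I = win 1 (suc e)

  -- deleting the first or the last letter of τ gives different permutations, as τ is not monotone
  S≢P : S ≢ P
  S≢P S≡P = τ-nonmono (subst Monotone (sym win-full) (shift-monotone (suc (suc e)) S≡P))

  I-perm : IsPerm I
  I-perm = win-perm 1 (suc e) (s≤s (s≤s (n≤1+n _))) (s≤s z≤n)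

  τ⋗P : τ ⋗ P
  τ⋗P = subst (_⋗ P) (sym win-full) (win-⋖-init 0 (suc (suc e)) ≤-refl (s≤s z≤n))

  τ⋗S : τ ⋗ S
  τ⋗S = subst (_⋗ S) (sym win-full) (win-⋖-tail 0 (suc (suc e)) ≤-refl (s≤s z≤n))

  chain-S chain-P : List (List ℕ)
  chain-S = τ ∷ S ∷ I ∷ []
  chain-P = τ ∷ P ∷ I ∷ []

  maxchain-S : MaxChain I τ chain-S
  maxchain-S = (_ , refl) , refl , τ⋗S ∷ win-⋖-init 1 (suc e) ≤-refl (s≤s z≤n) ∷ [-]

  maxchain-P : MaxChain I τ chain-P
  maxchain-P = (_ , refl) , refl , τ⋗P ∷ win-⋖-tail 0 (suc e) (s≤s (s≤s (n≤1+n _))) (s≤s z≤n) ∷ [-]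

  length-P : length P ≡ suc (suc e)
  length-P = win-length 0 (suc (suc e)) (s≤s (s≤s (n≤1+n _)))

  length-I : length I ≡ suc e
  length-I = win-length 1 (suc e) (s≤s (s≤s (n≤1+n _)))

  covers-of-τ : ∀ {ρ} → τ ⋗ ρ → (ρ ≡ P) ⊎ (ρ ≡ S)
  covers-of-τ {ρ} τ⋗ρ = covered-by-window 0 (suc (suc e)) ≤-refl (subst (_⋗ ρ) win-full τ⋗ρ)

  -- a maximal chain passes through a cover of τ, that is P or S, and then reaches I in one step
  only : ∀ C → MaxChain I τ C → (C ≡ chain-S) ⊎ (C ≡ chain-P)
  only _ (([] , refl) , ends , _) = ⊥-elim (m≢1+n+m (suc e) {1} (sym (trans (cong length (just-injective ends)) length-I)))
  only _ ((ρ ∷ L , refl) , ends , τ⋗ρ ∷ links) = through (covers-of-τ τ⋗ρ)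
    where
    rest-is-I : ∀ {ρ′} → ρ ≡ ρ′ → length ρ′ ≡ suc (suc e) → L ≡ I ∷ []
    rest-is-I ρ≡ρ′ length-ρ′ =
      chain-one-step links ends I-perm (trans (cong length ρ≡ρ′) (trans length-ρ′ (cong suc (sym length-I))))
    through : (ρ ≡ P) ⊎ (ρ ≡ S) → (τ ∷ ρ ∷ L ≡ chain-S) ⊎ (τ ∷ ρ ∷ L ≡ chain-P)
    through (inj₁ ρ≡P) = inj₂ (cong₂ (λ ρ L → τ ∷ ρ ∷ L) ρ≡P (rest-is-I ρ≡P length-P))
    through (inj₂ ρ≡S) = inj₁ (cong₂ (λ ρ L → τ ∷ ρ ∷ L) ρ≡S (rest-is-I ρ≡S (win-length 1 (suc (suc e)) ≤-refl)))

  -- the chain through P deletes the last letter, then the first one: its id is  d 1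
  id-P : chainId τ chain-P ≡ suc (suc (suc e)) ∷ 1 ∷ []
  id-P = trans (idAux-last τ 0 _ τ P (I ∷ []) τ-nonmono S≢P) (cong (_ ∷_) (idAux-first τ 0 _ P I [] refl))

  id-S : chainId τ chain-S ≡ 1 ∷ idAux τ 1 (d ∸ 1) (S ∷ I ∷ [])
  id-S = idAux-first τ 0 _ τ S (I ∷ []) refl

  P∉chain-S : ∀ ρ → ρ ∈ P ∷ [] → ρ ∉ chain-S
  P∉chain-S ρ (here refl) (here P≡τ)                 = 1+n≢n (trans (sym (cong length P≡τ)) length-P)
  P∉chain-S ρ (here refl) (there (here P≡S))         = S≢P (sym P≡S)
  P∉chain-S ρ (here refl) (there (there (here P≡I))) = 1+n≢n (trans (sym length-P) (trans (cong length P≡I) length-I))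

  two-chains : TwoChainsProperty (interior τ) τ
  two-chains = TwoChains.two-chains-property maxchain-S maxchain-P only
    (subst₂ _<lex_ (sym id-S) (sym id-P) (this (s≤s (s≤s z≤n)))) (s≤s (s≤s z≤n)) P∉chain-S
    (subst StrictlyDecreasing (sym id-P) (s≤s (s≤s z≤n) ∷ [-]))

-- Let ξ = x(τ) have length k and ξ ⋠ i(τ).  The maximal chains of [ξ,τ] are the
-- chain of prefixes  τ ⋗ win 0 (d-1) ⋗ ⋯ ⋗ win 0 k  and the chain of suffixes
-- τ ⋗ win 1 (d-1) ⋗ ⋯ ⋗ win (d-k) k: leaving either would pass through a window inside
-- the interior, which lies above ξ.
module Exterior {x y z : ℕ} {r : List ℕ}
                (τ-perm : IsPerm (x ∷ y ∷ z ∷ r)) (τ-nonmono : ¬ Monotone (x ∷ y ∷ z ∷ r))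
                {ξ : List ℕ} (ξ-exterior : IsExterior (x ∷ y ∷ z ∷ r) ξ)
                (ξ⋠I : ¬ ξ ≼ interior (x ∷ y ∷ z ∷ r)) where

  open Interior τ-perm τ-nonmono using (τ; e; P; S; S≢P)
  open Windows τ τ-perm

  k : ℕ
  k = length ξ

  1≤k : 1 ≤ k
  1≤k = proj₁ (proj₁ ξ-exterior)

  k<d : k < d
  k<d = proj₁ (proj₂ (proj₁ ξ-exterior))

  ξ-prefix : ξ ≡ win 0 k
  ξ-prefix = sym (proj₂ (proj₂ (proj₁ ξ-exterior)))

  ξ-suffix : ξ ≡ win (d ∸ k) k
  ξ-suffix = trans (sym (proj₂ (proj₂ (proj₁ (proj₂ ξ-exterior))))) (suffix-window k (<⇒≤ k<d))

  ξ-perm : IsPerm ξ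
  ξ-perm = subst IsPerm (sym ξ-prefix) (win-perm 0 k (<⇒≤ k<d) 1≤k)

  d∸[d-1]≡1 : d ∸ suc (suc e) ≡ 1
  d∸[d-1]≡1 = m+n∸n≡m 1 (suc (suc e))

  ξ⋠inner : ∀ a m → 1 ≤ a → a + m ≤ suc (suc e) → ¬ ξ ≼ win a m
  ξ⋠inner (suc a) m _ fits ξ≼ = ξ⋠I (≼-trans ξ≼ (win-≼ 1 (suc e) a m (s≤s (s≤s (n≤1+n _))) (s≤s⁻¹ fits) 1≤m))
    where
    1≤m : 1 ≤ m
    1≤m = ≤-trans 1≤k (≤-trans (≼-length ξ≼) (≤-reflexive (win-length (suc a) m (≤-trans fits (n≤1+n _)))))

  -- ξ is shorter than d-1: otherwise  P = ξ = S
  k≤1+e : k ≤ suc e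
  k≤1+e with m≤n⇒m<n∨m≡n (s≤s⁻¹ k<d)
  ... | inj₁ k<2+e = s≤s⁻¹ k<2+e
  ... | inj₂ k≡2+e = ⊥-elim (S≢P (begin
    S                    ≡⟨ cong (λ a → win a (suc (suc e))) d∸[d-1]≡1 ⟨
    win (d ∸ suc (suc e)) (suc (suc e)) ≡⟨ cong (λ m → win (d ∸ m) m) k≡2+e ⟨
    win (d ∸ k) k        ≡⟨ ξ-suffix ⟨
    ξ                    ≡⟨ ξ-prefix ⟩
    win 0 k              ≡⟨ cong (win 0) k≡2+e ⟩
    P                    ∎))
    where open ≡-Reasoning

  -- prefixes longer than ξ are not monotone: otherwise ξ would also be the window at position 2
  prefix-nonmonotone : ∀ m → k < m → m ≤ d → ¬ Monotone (win 0 m)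
  prefix-nonmonotone m k<m m≤d mono with m≤n⇒m<n∨m≡n m≤d
  ... | inj₂ refl = τ-nonmono (subst Monotone (sym win-full) mono)
  ... | inj₁ m<d  = ξ⋠inner 1 k ≤-refl (≤-trans k<m (s≤s⁻¹ m<d))
                      (subst (ξ ≼_) (trans ξ-prefix (monotone-prefix-shift m k (<⇒≤ m<d) k<m mono)) (≼-refl ξ-perm))

  -- prefixes longer than ξ differ from the suffixes of the same length, by maximality of ξ
  prefix≢suffix : ∀ m → k < m → m < d → win 0 m ≢ win (d ∸ m) m
  prefix≢suffix m k<m m<d prefix≡suffix =
    <⇒≱ k<m (subst (_≤ k) length-m (proj₂ (proj₂ ξ-exterior) (win 0 m) proper-prefix suffix))
    where
    length-m : length (win 0 m) ≡ m
    length-m = win-length 0 m (<⇒≤ m<d)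
    1≤m : 1 ≤ length (win 0 m)
    1≤m = subst (1 ≤_) (sym length-m) (≤-trans 1≤k (<⇒≤ k<m))
    proper-prefix : ProperPrefix (win 0 m) τ
    proper-prefix = 1≤m , subst (_< d) (sym length-m) m<d , cong (λ n → std (take n τ)) length-m
    suffix : Suffix (win 0 m) τ
    suffix = 1≤m , subst (_≤ d) (sym length-m) (<⇒≤ m<d) ,
             trans (cong (λ n → std (drop (d ∸ n) τ)) length-m) (trans (suffix-window m (<⇒≤ m<d)) (sym prefix≡suffix))

  -- ladder s n : the windows  win (s m) m  for m = n+k, n+k-1, …, k,  placed by the start function s
  ladder : (ℕ → ℕ) → ℕ → List (List ℕ)
  ladder s zero    = win (s k) k ∷ []
  ladder s (suc n) = win (s (suc n + k)) (suc n + k) ∷ ladder s n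

  length-ladder : ∀ s n → length (ladder s n) ≡ suc n
  length-ladder s zero    = refl
  length-ladder s (suc n) = cong suc (length-ladder s n)

  ladder-last : ∀ s n → last (ladder s n) ≡ just (win (s k) k)
  ladder-last s zero          = refl
  ladder-last s (suc zero)    = refl
  ladder-last s (suc (suc n)) = ladder-last s (suc n)

  ∈-ladder : ∀ {ρ} s n → ρ ∈ ladder s n → ∃ λ m → (m ≤ n) × (ρ ≡ win (s (m + k)) (m + k))
  ∈-ladder s zero    (here ρ≡)  = 0 , z≤n , ρ≡
  ∈-ladder s (suc n) (here ρ≡)  = suc n , ≤-refl , ρ≡
  ∈-ladder s (suc n) (there ρ∈) with ∈-ladder s n ρ∈
  ... | m , m≤n , ρ≡ = m , m≤n⇒m≤1+n m≤n , ρ≡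

  ∈-ladder-upper : ∀ {ρ} s n → ρ ∈ take (suc n) (ladder s (suc n)) →
                   ∃ λ m → (m ≤ n) × (ρ ≡ win (s (suc m + k)) (suc m + k))
  ∈-ladder-upper s n       (here ρ≡)  = n , ≤-refl , ρ≡
  ∈-ladder-upper s (suc n) (there ρ∈) with ∈-ladder-upper s n ρ∈
  ... | m , m≤n , ρ≡ = m , m≤n⇒m≤1+n m≤n , ρ≡

  Rungs : (ℕ → ℕ) → Set
  Rungs s = ∀ m → k ≤ m → suc m < d → win (s (suc m)) (suc m) ⋗ win (s m) m

  ladder-chain : ∀ {s} → Rungs s → ∀ n → n + k < d → Linked _⋗_ (ladder s n)
  ladder-chain rung zero          _    = [-]
  ladder-chain rung (suc zero)    fits = rung k ≤-refl fits ∷ [-]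
  ladder-chain rung (suc (suc n)) fits = rung (suc n + k) (m≤n+m k (suc n)) fits ∷ ladder-chain rung (suc n) (<-trans (n<1+n _) fits)

  Forced : (ℕ → ℕ) → Set
  Forced s = ∀ m → k ≤ m → suc m < d → ∀ ρ → win (s (suc m)) (suc m) ⋗ ρ → ξ ≼ ρ → ρ ≡ win (s m) m

  ladder-unique : ∀ {s} → Forced s → ξ ≡ win (s k) k → (∀ m → m < d → s m + m ≤ d) →
                  ∀ n → n + k < d → ∀ {ρ} L → ρ ≡ win (s (n + k)) (n + k) →
                  Linked _⋗_ (ρ ∷ L) → last (ρ ∷ L) ≡ just ξ → ρ ∷ L ≡ ladder s n
  ladder-unique forced ξ≡ s-fits zero _ L ρ≡ links ends =
    cong₂ _∷_ ρ≡ (chain-stops links ends ξ-perm (trans (cong length ρ≡) (cong length (sym ξ≡))))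
  ladder-unique {s} forced ξ≡ s-fits (suc n) fits {ρ} [] ρ≡ _ ends = ⊥-elim (m≢1+n+m k {n} (sym (begin
    suc n + k                                 ≡⟨ win-length _ _ (s-fits _ fits) ⟨
    length (win (s (suc n + k)) (suc n + k))  ≡⟨ cong length ρ≡ ⟨
    length ρ                                  ≡⟨ cong length (just-injective ends) ⟩
    length ξ                                  ∎)))
    where open ≡-Reasoning
  ladder-unique {s} forced ξ≡ s-fits (suc n) fits (ρ′ ∷ L) ρ≡ (ρ⋗ρ′ ∷ links) ends =
    cong₂ _∷_ ρ≡ (ladder-unique forced ξ≡ s-fits n (<-trans (n<1+n _) fits) L ρ′≡ links ends)
    where
    ρ′≡ : ρ′ ≡ win (s (n + k)) (n + k)
    ρ′≡ = forced (n + k) (m≤n+m k n) fits ρ′ (subst (_⋗ ρ′) ρ≡ ρ⋗ρ′) (chain-below links ends ξ-perm)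

  prefixes suffixes : ℕ → List (List ℕ)
  prefixes = ladder (λ _ → 0)
  suffixes = ladder (d ∸_)

  suffix-fits : ∀ m → m ≤ d → d ∸ m + m ≤ d
  suffix-fits m m≤d = ≤-reflexive (m∸n+n≡m m≤d)

  suffix-start-step : ∀ m → suc m ≤ d → suc (d ∸ suc m) ≡ d ∸ m
  suffix-start-step m m<d = sym (+-∸-assoc 1 m<d)

  prefix-rungs : Rungs (λ _ → 0)
  prefix-rungs m k≤m m+1<d = win-⋖-init 0 m (<⇒≤ m+1<d) (≤-trans 1≤k k≤m)

  suffix-rungs : Rungs (d ∸_)
  suffix-rungs m k≤m m+1<d = subst (λ a → win (d ∸ suc m) (suc m) ⋗ win a m) (suffix-start-step m (<⇒≤ m+1<d))
    (win-⋖-tail (d ∸ suc m) m (suffix-fits (suc m) (<⇒≤ m+1<d)) (≤-trans 1≤k k≤m))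

  -- below a prefix, the other subwindow lies inside the interior
  prefix-forced : Forced (λ _ → 0)
  prefix-forced m k≤m m+1<d ρ top⋗ρ ξ≼ρ with covered-by-window 0 m (<⇒≤ m+1<d) top⋗ρ
  ... | inj₁ ρ≡ = ρ≡
  ... | inj₂ ρ≡ = ⊥-elim (ξ⋠inner 1 m ≤-refl (s≤s⁻¹ m+1<d) (subst (ξ ≼_) ρ≡ ξ≼ρ))

  -- below a suffix, likewise
  suffix-forced : Forced (d ∸_)
  suffix-forced m k≤m m+1<d ρ top⋗ρ ξ≼ρ with covered-by-window (d ∸ suc m) m (suffix-fits (suc m) (<⇒≤ m+1<d)) top⋗ρ
  ... | inj₁ ρ≡ = ⊥-elim (ξ⋠inner (d ∸ suc m) m (m<n⇒0<n∸m m+1<d) inner-fits (subst (ξ ≼_) ρ≡ ξ≼ρ))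
    where
    inner-fits : d ∸ suc m + m ≤ suc (suc e)
    inner-fits = s≤s⁻¹ (≤-reflexive (trans (sym (+-suc (d ∸ suc m) m)) (m∸n+n≡m (<⇒≤ m+1<d))))
  ... | inj₂ ρ≡ = trans ρ≡ (cong (λ a → win a m) (suffix-start-step m (<⇒≤ m+1<d)))

  descending : ℕ → List ℕ
  descending zero    = []
  descending (suc n) = suc n + k ∷ descending n

  descending-decreasing : ∀ n → StrictlyDecreasing (descending n)
  descending-decreasing zero          = []
  descending-decreasing (suc zero)    = [-]
  descending-decreasing (suc (suc n)) = ≤-refl ∷ descending-decreasing (suc n)

  -- a prefix longer than ξ has distinct subwindows one letter shorter, as it is not monotone
  prefix-no-shift : ∀ m → k ≤ m → suc m ≤ d → win 1 m ≢ win 0 m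
  prefix-no-shift m k≤m fits shift = prefix-nonmonotone (suc m) (s≤s k≤m) fits (shift-monotone m shift)

  -- so going down the prefixes every step deletes the last letter
  prefix-ids : ∀ n → suc n + k ≤ d → idAux τ 0 (suc n + k) (win 0 (suc n + k) ∷ prefixes n) ≡ descending (suc n)
  prefix-ids zero fits =
    idAux-last τ 0 (suc k) (win 0 (suc k)) (win 0 k) [] (prefix-nonmonotone (suc k) ≤-refl fits) (prefix-no-shift k ≤-refl fits)
  prefix-ids (suc n) fits = trans
    (idAux-last τ 0 (suc (suc n) + k) (win 0 (suc (suc n) + k)) (win 0 (suc n + k)) (prefixes n)
      (prefix-nonmonotone (suc (suc n) + k) (s≤s (m≤n+m k (suc n))) fits) (prefix-no-shift (suc n + k) (m≤n+m k (suc n)) fits))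
    (cong (suc (suc n) + k ∷_) (prefix-ids n (<⇒≤ fits)))

  ≡-window-length : ∀ {ρ} a b → a + b ≤ d → ρ ≡ win a b → length ρ ≡ b
  ≡-window-length a b fits ρ≡ = trans (cong length ρ≡) (win-length a b fits)

  module Chains (N : ℕ) (N+k≡ : suc N + k ≡ suc (suc e)) where

    prefix-chain suffix-chain : List (List ℕ)
    prefix-chain = τ ∷ prefixes (suc N)
    suffix-chain = τ ∷ suffixes (suc N)

    top<d : suc N + k < d
    top<d = s≤s (≤-reflexive N+k≡)

    τ≡top : τ ≡ win 0 (suc (suc N + k))
    τ≡top = trans win-full (cong (win 0) (sym (cong suc N+k≡)))

    S-start : d ∸ (suc N + k) ≡ 1
    S-start = trans (cong (d ∸_) N+k≡) d∸[d-1]≡1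

    maxchain-prefixes : MaxChain ξ τ prefix-chain
    maxchain-prefixes = (_ , refl) , trans (ladder-last _ (suc N)) (cong just (sym ξ-prefix)) ,
      subst (_⋗ win 0 (suc N + k)) (sym τ≡top) (win-⋖-init 0 (suc N + k) top<d (≤-trans 1≤k (m≤n+m k (suc N))))
      ∷ ladder-chain prefix-rungs (suc N) top<d

    maxchain-suffixes : MaxChain ξ τ suffix-chain
    maxchain-suffixes = (_ , refl) , trans (ladder-last _ (suc N)) (cong just (sym ξ-suffix)) ,
      subst₂ _⋗_ (sym τ≡top) (cong (λ a → win a (suc N + k)) (sym S-start))
        (win-⋖-tail 0 (suc N + k) top<d (≤-trans 1≤k (m≤n+m k (suc N))))
      ∷ ladder-chain suffix-rungs (suc N) top<d

    -- a maximal chain passes through a cover of τ, the top of one of the ladders, and then stays on it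
    only : ∀ C → MaxChain ξ τ C → (C ≡ suffix-chain) ⊎ (C ≡ prefix-chain)
    only _ (([] , refl) , ends , _) = ⊥-elim (<-irrefl (sym (cong length (just-injective ends))) k<d)
    only _ ((ρ ∷ L , refl) , ends , τ⋗ρ ∷ links) =
      through (covered-by-window 0 (suc N + k) top<d (subst (_⋗ ρ) τ≡top τ⋗ρ))
      where
      through : (ρ ≡ win 0 (suc N + k)) ⊎ (ρ ≡ win 1 (suc N + k)) →
                (τ ∷ ρ ∷ L ≡ suffix-chain) ⊎ (τ ∷ ρ ∷ L ≡ prefix-chain)
      through (inj₁ ρ≡) = inj₂ (cong (τ ∷_)
        (ladder-unique prefix-forced ξ-prefix (λ _ → <⇒≤) (suc N) top<d L ρ≡ links ends))
      through (inj₂ ρ≡) = inj₁ (cong (τ ∷_) (ladder-unique suffix-forced ξ-suffix (λ m → suffix-fits m ∘ <⇒≤) (suc N) top<d L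
                                  (trans ρ≡ (cong (λ a → win a (suc N + k)) (sym S-start))) links ends))

    id-prefixes : chainId τ prefix-chain ≡ descending (suc (suc N))
    id-prefixes = begin
      idAux τ 0 d (τ ∷ prefixes (suc N))
        ≡⟨ cong (λ ρ → idAux τ 0 d (ρ ∷ prefixes (suc N))) win-full ⟩
      idAux τ 0 d (win 0 d ∷ prefixes (suc N))
        ≡⟨ cong (λ m → idAux τ 0 m (win 0 m ∷ prefixes (suc N))) (cong suc N+k≡) ⟨
      idAux τ 0 (suc (suc N + k)) (win 0 (suc (suc N + k)) ∷ prefixes (suc N))
        ≡⟨ prefix-ids (suc N) (≤-reflexive (cong suc N+k≡)) ⟩
      descending (suc (suc N)) ∎
      where open ≡-Reasoning

    id-suffixes : chainId τ suffix-chain ≡ 1 ∷ idAux τ 1 (d ∸ 1) (suffixes (suc N))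
    id-suffixes = idAux-first τ 0 d τ _ (suffixes N) (cong₂ win (sym S-start) (sym N+k≡))

    prefixes∉suffix-chain : ∀ ρ → ρ ∈ take (length (prefixes (suc N)) ∸ 1) (prefixes (suc N)) → ρ ∉ suffix-chain
    prefixes∉suffix-chain ρ ρ∈ ρ∈S
      with ∈-ladder-upper (λ _ → 0) N (subst (λ t → ρ ∈ take t (prefixes (suc N))) (length-ladder (λ _ → 0) N) ρ∈)
    ... | m , m≤N , ρ≡prefix = not-on-S ρ∈S
      where
      m+k<d : suc m + k < d
      m+k<d = ≤-trans (s≤s (+-monoˡ-≤ k (s≤s m≤N))) top<d
      length-ρ : length ρ ≡ suc m + k
      length-ρ = ≡-window-length 0 (suc m + k) (<⇒≤ m+k<d) ρ≡prefix
      not-on-S : ρ ∉ suffix-chain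
      not-on-S (here ρ≡τ)         = <-irrefl (cong length ρ≡τ) (subst (_< d) (sym length-ρ) m+k<d)
      not-on-S (there ρ∈suffixes) with ∈-ladder _ (suc N) ρ∈suffixes
      ... | m′ , m′≤1+N , ρ≡suffix = prefix≢suffix (suc m + k) (s≤s (m≤n+m k m)) m+k<d
            (trans (sym ρ≡prefix) (trans ρ≡suffix (cong (λ t → win (d ∸ t) t) (trans (sym same-length) length-ρ))))
        where
        m′+k≤d : m′ + k ≤ d
        m′+k≤d = ≤-trans (+-monoˡ-≤ k m′≤1+N) (<⇒≤ top<d)
        same-length : length ρ ≡ m′ + k
        same-length = ≡-window-length (d ∸ (m′ + k)) (m′ + k) (suffix-fits _ m′+k≤d) ρ≡suffix

    two-chains : TwoChainsProperty ξ τ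
    two-chains = TwoChains.two-chains-property maxchain-suffixes maxchain-prefixes only
      (subst₂ _<lex_ (sym id-suffixes) (sym id-prefixes) (this (s≤s (s≤s z≤n))))
      (≤-trans (s≤s (s≤s z≤n)) (≤-reflexive (sym (length-ladder _ (suc N))))) prefixes∉suffix-chain
      (subst StrictlyDecreasing (sym id-prefixes) (descending-decreasing (suc (suc N))))

  -- statement (2): the ladders have N + 1 = d-1-k ≥ 1 rungs, as k ≤ d-2
  two-chains : TwoChainsProperty ξ τ
  two-chains = Chains.two-chains (suc e ∸ k) (cong suc (m∸n+n≡m k≤1+e))

-- permutations of length 2 are monotone; for longer ones combine statements (1) and (2)
lemma2p4 : (τ : List ℕ) → IsPerm τ → 2 ≤ length τ → ¬ Monotone τ →
    TwoChainsProperty (interior τ) τ ×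
    (∀ ξ → IsExterior τ ξ → ¬ (ξ ≼ interior τ) → TwoChainsProperty ξ τ)
lemma2p4 []              _      ()              _
lemma2p4 (x ∷ [])        _      (s≤s ())        _
lemma2p4 (x ∷ y ∷ [])    τ-perm _ τ-nonmono with perm-unique τ-perm
... | (x≢y ∷ _) ∷ _ = ⊥-elim (τ-nonmono (pair-monotone x≢y))
lemma2p4 (x ∷ y ∷ z ∷ r) τ-perm _ τ-nonmono =
  Interior.two-chains τ-perm τ-nonmono ,
  λ ξ ξ-exterior ξ⋠interior → Exterior.two-chains τ-perm τ-nonmono ξ-exterior ξ⋠interior
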